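{- Let $G=(V,E)$ be a graph satisfying the standing assumptions. Let $u,v\in V$ with $\min_u=\min_v$, let $(u_i)_{i\ge1}$ be an occurrence of $\min_u$ and $(v_i)_{i\ge1}$ an occurrence of $\min_v$. Then for every $i\ge1$: (1) $\lambda(u_i)=\lambda(v_i)$; (2) $\min_{u_i}=\min_{v_i}$; (3) $\tau(u_i)=\tau(v_i)$. In particular, these hold when $u=v$ and $(u_i)$, $(v_i)$ are two distinct occurrences of $\min_u$.
   Context: Standing assumptions: $\Sigma$ is a finite alphabet with a total order $\preceq$; $G=(V,E)$ is finite, $E\subseteq V\times V\times\Sigma$, every node has an incoming edge, all edges entering a node $u$ have the same label $\lambda(u)$ (edges are written $(u,v)$), and $G$ is deterministic. An occurrence of $\alpha\in\Sigma^\omega$ starting at $u$ is a sequence $(u_i)_{i\ge1}$ with $u_1=u$, $(u_{i+1},u_i)\in E$, $\lambda(u_i)=\alpha[i]$; $\min_u$ is the lexicographically smallest string in $\Sigma^\omega$ with an occurrence starting at $u$. For $\alpha=a\alpha'$ ($a\in\Sigma$): $\tau(\alpha)=1$ if $\alpha'\prec\alpha$, $2$ if $\alpha'=\alpha$, $3$ if $\alpha\prec\alpha'$; $\tau(u):=\tau(\min_u)$. -}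

module Defs where

open import Data.Nat using (ℕ; zero; suc)
open import Data.Fin using (Fin)
open import Data.Fin.Base using () renaming (_<_ to _<ᶠ_)
open import Data.Bool using (Bool; true)
open import Data.Product using (Σ; ∃; _×_; _,_)
open import Data.Sum using (_⊎_)
open import Relation.Binary.PropositionalEquality using (_≡_)

-- Alphabet Σ = Fin k with the total order of Fin (any finite totally
-- ordered alphabet is order-isomorphic to such a Fin k).
-- ω-strings over Σ: functions ℕ → Fin k, indexed from 0
-- (position 0 here = position 1 in the paper).
ωString : ℕ → Set
ωString k = ℕ → Fin k

_≐_ : {k : ℕ} → ωString k → ωString k → Set
α ≐ β = ∀ i → α i ≡ β i

_≺_ : {k : ℕ} → ωString k → ωString k → Set
α ≺ β = Σ ℕ λ j → ((i : ℕ) → i Data.Nat.< j → α i ≡ β i) × (α j <ᶠ β j)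

_⪯_ : {k : ℕ} → ωString k → ωString k → Set
α ⪯ β = (α ≺ β) ⊎ (α ≐ β)

tail : {k : ℕ} → ωString k → ωString k
tail α i = α (suc i)

-- Finite, node-labelled (input-consistent), deterministic graph on
-- nodes Fin n over alphabet Fin k.  edge u v ≡ true means (u,v) ∈ E,
-- and the label of that edge is label v (= λ(v)).
record Graph (k n : ℕ) : Set where
  field
    edge  : Fin n → Fin n → Bool
    label : Fin n → Fin k
    hasIn : (v : Fin n) → ∃ λ u → edge u v ≡ true
    det   : (u v w : Fin n) → edge u v ≡ true → edge u w ≡ true →
            label v ≡ label w → v ≡ w

module _ {k n : ℕ} (G : Graph k n) where
  open Graph G

  Occurrence : ωString k → Fin n → (ℕ → Fin n) → Set
  Occurrence α u us =
    (us 0 ≡ u) ×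
    ((i : ℕ) → edge (us (suc i)) (us i) ≡ true) ×
    ((i : ℕ) → label (us i) ≡ α i)

  HasOcc : ωString k → Fin n → Set
  HasOcc α u = Σ (ℕ → Fin n) λ us → Occurrence α u us

  IsMin : Fin n → ωString k → Set
  IsMin u α = HasOcc α u × ((β : ωString k) → HasOcc β u → α ⪯ β)

data TauIs {k : ℕ} (α : ωString k) : ℕ → Set where
  τ1 : tail α ≺ α → TauIs α 1
  τ2 : tail α ≐ α → TauIs α 2
  τ3 : α ≺ tail α → TauIs α 3

TauNode : {k n : ℕ} → Graph k n → Fin n → ℕ → Set
TauNode G u t = Σ _ λ β → IsMin G u β × TauIs β t

{-# OPTIONS --safe #-}

-- Minimality of min_u is inherited along an occurrence: if (u_i) is an
-- occurrence of min_u, then the i-th suffix of min_u is min_{u_i}, since any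
-- smaller string at u_i could be prefixed by the labels of u_1 … u_{i-1} to
-- give a smaller string at u.  So along occurrences of the same string α
-- starting at u and v, both u_i and v_i have the same minimal string, namely
-- the i-th suffix of α; labels, minimal strings and τ then agree.
module Submission where

open import Defs
open import Data.Nat using (ℕ; zero; suc; _+_; s<s)
open import Data.Nat.Properties using (<-cmp)
open import Data.Fin using (Fin; _<_)
open import Data.Fin.Properties using (<-irrefl; <-asym)
open import Data.Product using (_×_; _,_)
open import Data.Sum using (inj₁; inj₂)
open import Data.Empty using (⊥-elim)
open import Data.Bool using (true)
open import Relation.Binary.Definitions using (tri<; tri≈; tri>)
open import Relation.Binary.PropositionalEquality using (_≡_; refl; sym; trans; subst)
open import Function.Bundles using (_⇔_; mk⇔)

drop : {A : Set} → ℕ → (ℕ → A) → ℕ → A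
drop i f j = f (i + j)

cons : {A : Set} → A → (ℕ → A) → ℕ → A
cons a f zero    = a
cons a f (suc j) = f j

module _ {k : ℕ} where

  ⪯-antisym : {α β : ωString k} → α ⪯ β → β ⪯ α → α ≐ β
  ⪯-antisym (inj₂ α≐β) _          = α≐β
  ⪯-antisym (inj₁ _)   (inj₂ β≐α) = λ i → sym (β≐α i)
  ⪯-antisym (inj₁ (j₁ , agree₁ , lt₁)) (inj₁ (j₂ , agree₂ , lt₂)) with <-cmp j₁ j₂
  ... | tri< j₁<j₂ _ _ = ⊥-elim (<-irrefl (sym (agree₂ j₁ j₁<j₂)) lt₁)
  ... | tri≈ _ refl _  = ⊥-elim (<-asym lt₁ lt₂)
  ... | tri> _ _ j₂<j₁ = ⊥-elim (<-irrefl (sym (agree₁ j₂ j₂<j₁)) lt₂)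

  ⪯-respˡ-≐ : {α β γ : ωString k} → α ≐ β → α ⪯ γ → β ⪯ γ
  ⪯-respˡ-≐ α≐β (inj₁ (j , agree , lt)) =
    inj₁ (j , (λ i i<j → trans (sym (α≐β i)) (agree i i<j))
            , subst (_< _) (α≐β j) lt)
  ⪯-respˡ-≐ α≐β (inj₂ α≐γ) = inj₂ (λ i → trans (sym (α≐β i)) (α≐γ i))

  ⪯-tail : {α β : ωString k} → α 0 ≡ β 0 → α ⪯ β → tail α ⪯ tail β
  ⪯-tail head≡ (inj₁ (zero  , _ , lt))     = ⊥-elim (<-irrefl head≡ lt)
  ⪯-tail head≡ (inj₁ (suc j , agree , lt)) = inj₁ (j , (λ i i<j → agree (suc i) (s<s i<j)) , lt)
  ⪯-tail head≡ (inj₂ α≐β)                  = inj₂ (λ i → α≐β (suc i))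

module _ {k n : ℕ} (G : Graph k n) where
  open Graph G

  Occurrence-tail : {α : ωString k} {u : Fin n} {us : ℕ → Fin n} →
                    Occurrence G α u us → Occurrence G (tail α) (us 1) (tail us)
  Occurrence-tail (_ , edges , labels) = refl , (λ j → edges (suc j)) , (λ j → labels (suc j))

  HasOcc-cons : {β : ωString k} {u w : Fin n} →
                edge w u ≡ true → HasOcc G β w → HasOcc G (cons (label u) β) u
  HasOcc-cons {u = u} w→u (ws , refl , edges , labels) = cons u ws , refl , edges′ , labels′
    where
    edges′ : (j : ℕ) → edge (cons u ws (suc j)) (cons u ws j) ≡ true
    edges′ zero    = w→u
    edges′ (suc j) = edges j
    labels′ : (j : ℕ) → label (cons u ws j) ≡ cons (label u) _ j
    labels′ zero    = refl
    labels′ (suc j) = labels j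

  IsMin-tail : {α : ωString k} {u : Fin n} {us : ℕ → Fin n} →
               IsMin G u α → Occurrence G α u us → IsMin G (us 1) (tail α)
  IsMin-tail {α} {us = us} (_ , minimal) occ@(refl , edges , labels) =
    (tail us , Occurrence-tail occ) , tail-minimal
    where
    tail-minimal : (β : ωString k) → HasOcc G β (us 1) → tail α ⪯ β
    tail-minimal β occβ =
      ⪯-tail (sym (labels 0)) (minimal (cons (label (us 0)) β) (HasOcc-cons (edges 0) occβ))

  IsMin-drop : {α : ωString k} {u : Fin n} {us : ℕ → Fin n} (i : ℕ) →
               IsMin G u α → Occurrence G α u us → IsMin G (us i) (drop i α)
  IsMin-drop zero    isMin (refl , _) = isMin
  IsMin-drop (suc i) isMin occ        =
    IsMin-drop i (IsMin-tail isMin occ) (Occurrence-tail occ)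

  IsMin-unique : {w : Fin n} {α β : ωString k} → IsMin G w α → IsMin G w β → α ≐ β
  IsMin-unique (occα , minα) (occβ , minβ) = ⪯-antisym (minα _ occβ) (minβ _ occα)

  IsMin-resp-≐ : {w : Fin n} {α β : ωString k} → α ≐ β → IsMin G w α → IsMin G w β
  IsMin-resp-≐ α≐β ((ws , w0 , edges , labels) , minimal) =
    (ws , w0 , edges , λ j → trans (labels j) (α≐β j)) ,
    λ γ occγ → ⪯-respˡ-≐ α≐β (minimal γ occγ)

  IsMin-transfer : {w w′ : Fin n} {α β : ωString k} →
                   IsMin G w α → IsMin G w′ α → IsMin G w β → IsMin G w′ β
  IsMin-transfer minw minw′ minβ = IsMin-resp-≐ (IsMin-unique minw minβ) minw′

  IsMin-⇔ : {w w′ : Fin n} {α : ωString k} → IsMin G w α → IsMin G w′ α →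
            (β : ωString k) → IsMin G w β ⇔ IsMin G w′ β
  IsMin-⇔ minw minw′ β = mk⇔ (IsMin-transfer minw minw′) (IsMin-transfer minw′ minw)

  TauNode-⇔ : {w w′ : Fin n} {α : ωString k} → IsMin G w α → IsMin G w′ α →
              (t : ℕ) → TauNode G w t ⇔ TauNode G w′ t
  TauNode-⇔ minw minw′ t =
    mk⇔ (λ (β , minβ , τβ) → β , IsMin-transfer minw minw′ minβ , τβ)
        (λ (β , minβ , τβ) → β , IsMin-transfer minw′ minw minβ , τβ)

lemma12 : {k n : ℕ} (G : Graph k n) (u v : Fin n) (α : ωString k) →
          IsMin G u α → IsMin G v α →
          (us vs : ℕ → Fin n) →
          Occurrence G α u us → Occurrence G α v vs →
          (i : ℕ) →
            (Graph.label G (us i) ≡ Graph.label G (vs i))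
            × ((β : ωString k) → IsMin G (us i) β ⇔ IsMin G (vs i) β)
            × ((t : ℕ) → TauNode G (us i) t ⇔ TauNode G (vs i) t)
lemma12 G u v α minu minv us vs occu@(_ , _ , labelsu) occv@(_ , _ , labelsv) i =
  trans (labelsu i) (sym (labelsv i)) , IsMin-⇔ G minuᵢ minvᵢ , TauNode-⇔ G minuᵢ minvᵢ
  where
  minuᵢ : IsMin G (us i) (drop i α)
  minuᵢ = IsMin-drop G i minu occu
  minvᵢ : IsMin G (vs i) (drop i α)
  minvᵢ = IsMin-drop G i minv occv
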